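{- Let $\alpha\in[0,1]$ and let $T$ be a mixed tree of order $n$ and size $m$ with components $C_1,\dots,C_t$. Then $$\mathrm{char}(A_\alpha(T))=\prod_{i\in[t]}\mathrm{char}(A_\alpha(T)[C_i]),$$ where $A_\alpha(T)[C_i]$ is the principal submatrix of $A_\alpha(T)$ with rows and columns indexed by $C_i$.
   Context: Mixed graph on $[n]$: between two distinct vertices at most one of an arc $\vec{ij}$, an undirected edge $ij$, or nothing; adjacency matrix $a_{ij}=1$ iff $\vec{ij}$ or $ij\in E$; size = arcs plus twice undirected edges. $d^+_i=|\{j:\vec{ij}\text{ or }ij\in E\}|$, $A_\alpha(T)=\alpha\,\mathrm{diag}(d^+_i)+(1-\alpha)A$. A mixed tree is a mixed graph whose underlying graph is a tree. The components of a mixed tree $T$ are the connected components of the undirected forest obtained from $T$ by deleting all arcs (keeping undirected edges); there are $2n-m-1$ of them. $\mathrm{char}(M)=\det(\lambda I-M)$. -}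

module Defs where

open import Level using (Level)
open import Algebra.Bundles using (CommutativeRing)
open import Data.Nat using (ℕ; zero; suc)
open import Data.Fin using (Fin; zero; suc; _≟_; punchIn; inject₁)
open import Data.Bool using (Bool; true; false; _∧_; _∨_; if_then_else_)
open import Data.Product using (Σ; _×_; _,_)
open import Relation.Nullary using (¬_; does)
open import Relation.Binary.PropositionalEquality using (_≡_)
open import Relation.Binary.Construct.Closure.ReflexiveTransitive using (Star)
open import Function.Bundles using (Bijection)
open import Relation.Binary.PropositionalEquality using (setoid)
open import Function.Bundles using (_⤖_)

-- A mixed graph is given by its 0/1 adjacency matrix a : a i j = true iff
-- there is an arc i→j or an undirected edge ij.  The pair {i,j} carries
--   * nothing            iff a i j = a j i = false
--   * an arc i→j         iff a i j = true,  a j i = false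
--   * an undirected edge iff a i j = a j i = true
-- so such matrices (with no loops) are exactly the mixed graphs on [n].

record MixedGraph (n : ℕ) : Set where
  field
    adj      : Fin n → Fin n → Bool
    loopless : ∀ i → adj i i ≡ false
open MixedGraph public

underlying : ∀ {n} → MixedGraph n → Fin n → Fin n → Bool
underlying G i j = adj G i j ∨ adj G j i

undirectedEdge : ∀ {n} → MixedGraph n → Fin n → Fin n → Set
undirectedEdge G i j = (adj G i j ∧ adj G j i) ≡ true

underlyingEdge : ∀ {n} → MixedGraph n → Fin n → Fin n → Set
underlyingEdge G i j = underlying G i j ≡ true

countRow : ∀ {n} → (Fin n → Bool) → ℕ
countRow {zero}  f = zero
countRow {suc n} f = (if f zero then 1 else 0) Data.Nat.+ countRow (λ j → f (suc j))

sumℕ : ∀ {k} → (Fin k → ℕ) → ℕ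
sumℕ {zero}  f = zero
sumℕ {suc k} f = f zero Data.Nat.+ sumℕ (λ i → f (suc i))

countPairs : ∀ {n} → (Fin n → Fin n → Bool) → ℕ
countPairs f = sumℕ (λ i → countRow (f i))

-- number of edges of the underlying graph (each unordered pair counted once;
-- countPairs counts ordered pairs of the symmetric relation, i.e. twice)
-- We state |E| via  2|E| = countPairs (underlying G).

IsMixedTree : ∀ {n} → MixedGraph n → Set
IsMixedTree {n} G =
  (∀ i j → Star (underlyingEdge G) i j)
  × (countPairs (underlying G) ≡ 2 Data.Nat.* (n Data.Nat.∸ 1))
  × (1 Data.Nat.≤ n)

SameComponent : ∀ {n} → MixedGraph n → Fin n → Fin n → Set
SameComponent G = Star (undirectedEdge G)

outDeg : ∀ {n} → MixedGraph n → Fin n → ℕ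
outDeg G i = countRow (adj G i)

module _ {c ℓ : Level} (R : CommutativeRing c ℓ) where
  open CommutativeRing R hiding (zero)

  Matrix : ℕ → Set c
  Matrix k = Fin k → Fin k → Carrier

  fromℕ : ℕ → Carrier
  fromℕ zero    = 0#
  fromℕ (suc k) = 1# + fromℕ k

  fromBool : Bool → Carrier
  fromBool true  = 1#
  fromBool false = 0#

  δ : ∀ {k} → Fin k → Fin k → Carrier
  δ i j = if does (i ≟ j) then 1# else 0#

  ∑ : ∀ {k} → (Fin k → Carrier) → Carrier
  ∑ {zero}  f = 0#
  ∑ {suc k} f = f zero + ∑ (λ j → f (suc j))

  ∏ : ∀ {k} → (Fin k → Carrier) → Carrier
  ∏ {zero}  f = 1#
  ∏ {suc k} f = f zero * ∏ (λ j → f (suc j))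

  sign : ∀ {k} → Fin k → Carrier
  sign zero    = 1#
  sign (suc j) = - sign j

  det : ∀ {k} → Matrix k → Carrier
  det {zero}  M = 1#
  det {suc k} M = ∑ (λ j → sign j * (M zero j * det (λ r s → M (suc r) (punchIn j s))))

  charAt : ∀ {k} → Matrix k → Carrier → Carrier
  charAt M x = det (λ i j → (x * δ i j) - M i j)

  Aα : ∀ {n} → MixedGraph n → Carrier → Matrix n
  Aα G α i j = (α * fromℕ (outDeg G i)) * δ i j + (1# - α) * fromBool (adj G i j)

  principal : ∀ {n k} → Matrix n → (Fin k → Fin n) → Matrix k
  principal M e r s = M (e r) (e s)

record ComponentListing {n : ℕ} (G : MixedGraph n) : Set where
  field
    t      : ℕ
    size   : Fin t → ℕ
    elems  : (i : Fin t) → Fin (size i) → Fin n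
    partition : Σ (Fin t) (λ i → Fin (size i)) ⤖ Fin n
    partition-is-elems : ∀ i p → Bijection.to partition (i , p) ≡ elems i p
    connected-within : ∀ i p q → SameComponent G (elems i p) (elems i q)
    separated-between : ∀ i j p q → SameComponent G (elems i p) (elems j q) → i ≡ j

module Submission where

open import Level using (Level)
open import Algebra.Bundles using (CommutativeRing)
import Algebra.Properties.CommutativeMonoid.Sum as CommutativeMonoidSum
open import Data.Bool using (Bool; true; false; _∧_; _∨_; if_then_else_)
open import Data.Bool.Properties using (∨-comm; ∧-conicalˡ; ∧-conicalʳ)
open import Data.Empty using (⊥-elim)
open import Data.Fin using (Fin; zero; suc; toℕ; inject₁; punchIn; punchOut; splitAt; _↑ˡ_; _↑ʳ_; _≟_)
open import Data.Fin.Properties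
  using (splitAt-↑ˡ; splitAt-↑ʳ; splitAt⁻¹-↑ˡ; splitAt⁻¹-↑ʳ; punchIn-punchOut; punchOut-punchIn; punchInᵢ≢i; punchOut-cong)
open import Data.Fin.Permutation as Perm using (Permutation; Permutation′; _⟨$⟩ʳ_)
open import Data.List as List using (List; []; _∷_; _++_)
open import Data.Nat as ℕ using (ℕ; zero; suc; _≤_; _<_; s≤s; z≤n)
open import Data.Nat.Properties using (≤-refl; ≤-trans; ≰⇒≥; _≤?_; <-irrefl; <⇒≱)
open import Data.Product using (Σ; _×_; _,_; proj₁; proj₂)
open import Data.Product.Function.Dependent.Propositional using (Σ-↔)
open import Data.Sum using (_⊎_; inj₁; inj₂)
open import Function using (_∘_; _↔_; mk↔ₛ′; Inverse)
open import Function.Bundles using (Bijection; Injection)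
open import Function.Construct.Composition using (_↔-∘_)
open import Function.Construct.Identity using (↔-id)
open import Function.Properties.Bijection using (⤖⇒↔)
open import Function.Properties.Inverse using (↔⇒↣)
open import Relation.Binary.Construct.Closure.ReflexiveTransitive using (Star; ε; _◅_)
open import Relation.Binary.PropositionalEquality as ≡ using (_≡_; _≢_; refl; cong; cong₂; subst; subst₂)
open import Relation.Nullary using (yes; no; contradiction)

open import Defs

-- Because T is a tree, its vertices carry a potential: heights such that undirected edges join
-- vertices of equal height and every arc descends strictly. (Remove a leaf, take a potential of the
-- rest, and put the leaf at, above or below its neighbour, shifting the old heights if necessary.)
-- All vertices of a component then share a height, and every arc between two components goes from
-- the higher to the lower one. Off the diagonal, λI − A_α(T) is nonzero only along arcs and
-- undirected edges, so listing the components by increasing height and renumbering the vertices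
-- accordingly makes it block lower triangular. The determinant is invariant under such a
-- simultaneous permutation of rows and columns, and the determinant of a block triangular matrix is
-- the product of the determinants of its diagonal blocks, which are the λI − A_α(T)[Cᵢ].

-- Adjacent transpositions, block enumerations and sorting in Fin

adjacentSwap : ∀ {n} → Fin n → Fin (suc n) → Fin (suc n)
adjacentSwap zero    zero          = suc zero
adjacentSwap zero    (suc zero)    = zero
adjacentSwap zero    (suc (suc x)) = suc (suc x)
adjacentSwap (suc a) zero          = zero
adjacentSwap (suc a) (suc x)       = suc (adjacentSwap a x)

adjacentSwap-involutive : ∀ {n} (a : Fin n) x → adjacentSwap a (adjacentSwap a x) ≡ x
adjacentSwap-involutive zero    zero          = refl
adjacentSwap-involutive zero    (suc zero)    = refl
adjacentSwap-involutive zero    (suc (suc x)) = refl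
adjacentSwap-involutive (suc a) zero          = refl
adjacentSwap-involutive (suc a) (suc x)       = cong suc (adjacentSwap-involutive a x)

adjacentSwap-inject₁ : ∀ {n} (a : Fin n) → adjacentSwap a (inject₁ a) ≡ suc a
adjacentSwap-inject₁ zero    = refl
adjacentSwap-inject₁ (suc a) = cong suc (adjacentSwap-inject₁ a)

adjacentSwap-suc : ∀ {n} (a : Fin n) → adjacentSwap a (suc a) ≡ inject₁ a
adjacentSwap-suc zero    = refl
adjacentSwap-suc (suc a) = cong suc (adjacentSwap-suc a)

adjacentSwap-punchIn-suc : ∀ {n} (a : Fin n) s →
  adjacentSwap a (punchIn (suc a) s) ≡ punchIn (inject₁ a) s
adjacentSwap-punchIn-suc zero    zero    = refl
adjacentSwap-punchIn-suc zero    (suc s) = refl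
adjacentSwap-punchIn-suc (suc a) zero    = refl
adjacentSwap-punchIn-suc (suc a) (suc s) = cong suc (adjacentSwap-punchIn-suc a s)

adjacentSwap-punchIn-inject₁ : ∀ {n} (a : Fin n) s →
  adjacentSwap a (punchIn (inject₁ a) s) ≡ punchIn (suc a) s
adjacentSwap-punchIn-inject₁ a s = ≡.trans
  (cong (adjacentSwap a) (≡.sym (adjacentSwap-punchIn-suc a s))) (adjacentSwap-involutive a _)

adjacentSwapₚ : ∀ {n} → Fin n → Permutation′ (suc n)
adjacentSwapₚ a = Perm.permutation (adjacentSwap a) (adjacentSwap a)
  (adjacentSwap-involutive a) (adjacentSwap-involutive a)

adjacentSwap-cases : ∀ {k} (a : Fin (suc k)) (l : Fin (suc (suc k))) →
  l ≡ inject₁ a ⊎ l ≡ suc a ⊎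
  (adjacentSwap a l ≡ l × Σ (Fin k) λ b → ∀ s → adjacentSwap a (punchIn l s) ≡ punchIn l (adjacentSwap b s))
adjacentSwap-cases zero zero       = inj₁ refl
adjacentSwap-cases zero (suc zero) = inj₂ (inj₁ refl)
adjacentSwap-cases {suc k} zero (suc (suc l)) = inj₂ (inj₂ (refl , zero , commute))
  where
  commute : ∀ s → adjacentSwap zero (punchIn (suc (suc l)) s) ≡ punchIn (suc (suc l)) (adjacentSwap zero s)
  commute zero          = refl
  commute (suc zero)    = refl
  commute (suc (suc s)) = refl
adjacentSwap-cases (suc a) zero = inj₂ (inj₂ (refl , a , λ _ → refl))
adjacentSwap-cases {suc k} (suc a) (suc l) with adjacentSwap-cases a l
... | inj₁ refl                 = inj₁ refl
... | inj₂ (inj₁ refl)          = inj₂ (inj₁ refl)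
... | inj₂ (inj₂ (fixed , b , commute)) = inj₂ (inj₂ (cong suc fixed , suc b , commute′))
  where
  commute′ : ∀ s → adjacentSwap (suc a) (punchIn (suc l) s) ≡ punchIn (suc l) (adjacentSwap (suc b) s)
  commute′ zero    = refl
  commute′ (suc s) = cong suc (commute s)

-- punchOut without the proof obligation; junk value: punchOutTotal i i is an arbitrary element.
punchOutTotal : ∀ {n} → Fin (suc (suc n)) → Fin (suc (suc n)) → Fin (suc n)
punchOutTotal zero    zero    = zero
punchOutTotal zero    (suc j) = j
punchOutTotal (suc i) zero    = zero
punchOutTotal {suc n} (suc i) (suc j) = suc (punchOutTotal i j)
punchOutTotal {zero}  (suc i) (suc j) = zero

punchOutTotal-punchIn : ∀ {n} (i : Fin (suc (suc n))) j → punchOutTotal i (punchIn i j) ≡ j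
punchOutTotal-punchIn zero    j       = refl
punchOutTotal-punchIn (suc i) zero    = refl
punchOutTotal-punchIn {suc n} (suc i) (suc j) = cong suc (punchOutTotal-punchIn i j)
punchOutTotal-punchIn {zero}  (suc i) (suc ())

-- Deleting two positions in either order: first j and then l, or first a = punchIn j l and then j (renumbered).
punchIn-punchIn-swap : ∀ {n} (j : Fin (suc (suc n))) l s →
  let a = punchIn j l in punchIn j (punchIn l s) ≡ punchIn a (punchIn (punchOutTotal a j) s)
punchIn-punchIn-swap zero    l       s       = refl
punchIn-punchIn-swap (suc j) zero    s       = refl
punchIn-punchIn-swap {suc n} (suc j) (suc l) zero    = refl
punchIn-punchIn-swap {suc n} (suc j) (suc l) (suc s) = cong suc (punchIn-punchIn-swap j l s)
punchIn-punchIn-swap {zero}  (suc j) (suc ())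

applySwaps : ∀ {k} → List (Fin k) → Fin (suc k) → Fin (suc k)
applySwaps []      x = x
applySwaps (a ∷ w) x = adjacentSwap a (applySwaps w x)

applySwaps-++ : ∀ {k} (w₁ w₂ : List (Fin k)) x → applySwaps (w₁ ++ w₂) x ≡ applySwaps w₁ (applySwaps w₂ x)
applySwaps-++ []       w₂ x = refl
applySwaps-++ (a ∷ w₁) w₂ x = cong (adjacentSwap a) (applySwaps-++ w₁ w₂ x)

applySwaps-map-suc-zero : ∀ {k} (w : List (Fin k)) → applySwaps (List.map suc w) zero ≡ zero
applySwaps-map-suc-zero []      = refl
applySwaps-map-suc-zero (a ∷ w) = cong (adjacentSwap (suc a)) (applySwaps-map-suc-zero w)

applySwaps-map-suc-suc : ∀ {k} (w : List (Fin k)) y → applySwaps (List.map suc w) (suc y) ≡ suc (applySwaps w y)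
applySwaps-map-suc-suc []      y = refl
applySwaps-map-suc-suc (a ∷ w) y = cong (adjacentSwap (suc a)) (applySwaps-map-suc-suc w y)

insertionSwaps : ∀ {k} → Fin (suc k) → List (Fin k)
insertionSwaps zero = []
insertionSwaps {suc k} (suc c) = List.map suc (insertionSwaps c) ++ (zero ∷ [])

insertionSwaps-zero : ∀ {k} (c : Fin (suc k)) → applySwaps (insertionSwaps c) zero ≡ c
insertionSwaps-zero zero = refl
insertionSwaps-zero {suc k} (suc c) = begin
  applySwaps (List.map suc (insertionSwaps c) ++ zero ∷ []) zero
    ≡⟨ applySwaps-++ (List.map suc (insertionSwaps c)) _ zero ⟩
  applySwaps (List.map suc (insertionSwaps c)) (suc zero)
    ≡⟨ applySwaps-map-suc-suc (insertionSwaps c) zero ⟩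
  suc (applySwaps (insertionSwaps c) zero)
    ≡⟨ cong suc (insertionSwaps-zero c) ⟩
  suc c ∎
  where open ≡.≡-Reasoning

insertionSwaps-suc : ∀ {k} (c : Fin (suc k)) y → applySwaps (insertionSwaps c) (suc y) ≡ punchIn c y
insertionSwaps-suc zero y = refl
insertionSwaps-suc {suc k} (suc c) zero = ≡.trans
  (applySwaps-++ (List.map suc (insertionSwaps c)) _ (suc zero)) (applySwaps-map-suc-zero (insertionSwaps c))
insertionSwaps-suc {suc k} (suc c) (suc y) = begin
  applySwaps (List.map suc (insertionSwaps c) ++ zero ∷ []) (suc (suc y))
    ≡⟨ applySwaps-++ (List.map suc (insertionSwaps c)) _ _ ⟩
  applySwaps (List.map suc (insertionSwaps c)) (suc (suc y))
    ≡⟨ applySwaps-map-suc-suc (insertionSwaps c) (suc y) ⟩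
  suc (applySwaps (insertionSwaps c) (suc y))
    ≡⟨ cong suc (insertionSwaps-suc c y) ⟩
  suc (punchIn c y) ∎
  where open ≡.≡-Reasoning

permutation-adjacentSwaps : ∀ {k} (π : Permutation′ (suc k)) →
  Σ (List (Fin k)) λ w → ∀ x → π ⟨$⟩ʳ x ≡ applySwaps w x
permutation-adjacentSwaps {zero} π = [] , fixes
  where
  fixes : ∀ x → π ⟨$⟩ʳ x ≡ x
  fixes zero with π ⟨$⟩ʳ zero
  ... | zero = refl
permutation-adjacentSwaps {suc k} π = insertionSwaps c ++ List.map suc w , agrees
  where
  open ≡.≡-Reasoning
  c = π ⟨$⟩ʳ zero
  w = proj₁ (permutation-adjacentSwaps (Perm.remove zero π))
  agrees : ∀ x → π ⟨$⟩ʳ x ≡ applySwaps (insertionSwaps c ++ List.map suc w) x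
  agrees zero = ≡.sym (begin
    applySwaps (insertionSwaps c ++ List.map suc w) zero
      ≡⟨ applySwaps-++ (insertionSwaps c) _ zero ⟩
    applySwaps (insertionSwaps c) (applySwaps (List.map suc w) zero)
      ≡⟨ cong (applySwaps (insertionSwaps c)) (applySwaps-map-suc-zero w) ⟩
    applySwaps (insertionSwaps c) zero
      ≡⟨ insertionSwaps-zero c ⟩
    c ∎)
  agrees (suc y) = begin
    π ⟨$⟩ʳ suc y
      ≡⟨ Perm.punchIn-permute π zero y ⟩
    punchIn c (Perm.remove zero π ⟨$⟩ʳ y)
      ≡⟨ cong (punchIn c) (proj₂ (permutation-adjacentSwaps (Perm.remove zero π)) y) ⟩
    punchIn c (applySwaps w y)
      ≡⟨ ≡.sym (insertionSwaps-suc c _) ⟩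
    applySwaps (insertionSwaps c) (suc (applySwaps w y))
      ≡⟨ cong (applySwaps (insertionSwaps c)) (≡.sym (applySwaps-map-suc-suc w y)) ⟩
    applySwaps (insertionSwaps c) (applySwaps (List.map suc w) (suc y))
      ≡⟨ ≡.sym (applySwaps-++ (insertionSwaps c) _ (suc y)) ⟩
    applySwaps (insertionSwaps c ++ List.map suc w) (suc y) ∎

punchIn-↑ˡ : ∀ {a} b (r : Fin (suc a)) (s : Fin a) → punchIn (r ↑ˡ b) (s ↑ˡ b) ≡ punchIn r s ↑ˡ b
punchIn-↑ˡ b zero    s       = refl
punchIn-↑ˡ b (suc r) zero    = refl
punchIn-↑ˡ b (suc r) (suc s) = cong suc (punchIn-↑ˡ b r s)

punchIn-↑ˡ-↑ʳ : ∀ {a} b (r : Fin (suc a)) (s : Fin b) → punchIn (r ↑ˡ b) (a ↑ʳ s) ≡ suc a ↑ʳ s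
punchIn-↑ˡ-↑ʳ b zero    s = refl
punchIn-↑ˡ-↑ʳ {suc a} b (suc r) s = cong suc (punchIn-↑ˡ-↑ʳ b r s)

blockJoin : ∀ {t} (size : Fin t → ℕ) (i : Fin t) → Fin (size i) → Fin (sumℕ size)
blockJoin {suc t} size zero    p = p ↑ˡ sumℕ (size ∘ suc)
blockJoin {suc t} size (suc i) p = size zero ↑ʳ blockJoin (size ∘ suc) i p

blockSplit : ∀ {t} (size : Fin t → ℕ) → Fin (sumℕ size) → Σ (Fin t) (Fin ∘ size)
blockSplit {suc t} size x with splitAt (size zero) x
... | inj₁ p = zero , p
... | inj₂ y = let (i , p) = blockSplit (size ∘ suc) y in suc i , p

blockSplit-blockJoin : ∀ {t} (size : Fin t → ℕ) i p → blockSplit size (blockJoin size i p) ≡ (i , p)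
blockSplit-blockJoin {suc t} size zero p
  rewrite splitAt-↑ˡ (size zero) p (sumℕ (size ∘ suc)) = refl
blockSplit-blockJoin {suc t} size (suc i) p
  rewrite splitAt-↑ʳ (size zero) (sumℕ (size ∘ suc)) (blockJoin (size ∘ suc) i p)
        | blockSplit-blockJoin (size ∘ suc) i p = refl

blockJoin-blockSplit : ∀ {t} (size : Fin t → ℕ) x →
  let (i , p) = blockSplit size x in blockJoin size i p ≡ x
blockJoin-blockSplit {suc t} size x with splitAt (size zero) x in eq
... | inj₁ p = splitAt⁻¹-↑ˡ eq
... | inj₂ y = ≡.trans (cong (size zero ↑ʳ_) (blockJoin-blockSplit (size ∘ suc) y)) (splitAt⁻¹-↑ʳ eq)

blockSplit-↔ : ∀ {t} (size : Fin t → ℕ) → Fin (sumℕ size) ↔ Σ (Fin t) (Fin ∘ size)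
blockSplit-↔ size = mk↔ₛ′ (blockSplit size) (λ (i , p) → blockJoin size i p)
  (λ (i , p) → blockSplit-blockJoin size i p) (blockJoin-blockSplit size)

blockSplit-↑ˡ : ∀ {t} (size : Fin (suc t) → ℕ) p → proj₁ (blockSplit size (p ↑ˡ sumℕ (size ∘ suc))) ≡ zero
blockSplit-↑ˡ size p rewrite splitAt-↑ˡ (size zero) p (sumℕ (size ∘ suc)) = refl

blockSplit-↑ʳ : ∀ {t} (size : Fin (suc t) → ℕ) y →
  proj₁ (blockSplit size (size zero ↑ʳ y)) ≡ suc (proj₁ (blockSplit (size ∘ suc) y))
blockSplit-↑ʳ size y rewrite splitAt-↑ʳ (size zero) (sumℕ (size ∘ suc)) y = refl

argmin : ∀ {t} (key : Fin (suc t) → ℕ) → Σ (Fin (suc t)) λ m → ∀ i → key m ≤ key i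
argmin {zero} key = zero , λ { zero → ≤-refl }
argmin {suc t} key with argmin (key ∘ suc)
... | m , minimal with key zero ≤? key (suc m)
...   | yes k₀≤ = zero  , λ { zero → ≤-refl ; (suc i) → ≤-trans k₀≤ (minimal i) }
...   | no  k₀≰ = suc m , λ { zero → ≰⇒≥ k₀≰ ; (suc i) → minimal i }

sortingPermutation : ∀ {t} (key : Fin t → ℕ) →
  Σ (Permutation′ t) λ π → ∀ a b → toℕ a < toℕ b → key (π ⟨$⟩ʳ a) ≤ key (π ⟨$⟩ʳ b)
sortingPermutation {zero} key = Perm.id , λ ()
sortingPermutation {suc t} key = π , sorted
  where
  m = proj₁ (argmin key)
  π′ = sortingPermutation (key ∘ punchIn m)
  π : Permutation′ (suc t)
  π = Perm.insert zero m (proj₁ π′)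
  sorted : ∀ a b → toℕ a < toℕ b → key (π ⟨$⟩ʳ a) ≤ key (π ⟨$⟩ʳ b)
  sorted zero    b       _         = proj₂ (argmin key) _
  sorted (suc a) (suc b) (s≤s a<b) = subst₂ (λ u v → key u ≤ key v)
    (≡.sym (Perm.insert-punchIn zero m (proj₁ π′) a)) (≡.sym (Perm.insert-punchIn zero m (proj₁ π′) b))
    (proj₂ π′ a b a<b)

-- Sums and determinants over a commutative ring

module _ {c ℓ : Level} (R : CommutativeRing c ℓ) where
  open CommutativeRing R hiding (zero) renaming (refl to ≈-refl)
  open import Algebra.Properties.Group +-group using (∙-cancelˡ; ε⁻¹≈ε; ⁻¹-involutive)
  open import Algebra.Properties.AbelianGroup +-abelianGroup using (⁻¹-∙-comm)
  open import Algebra.Properties.Ring ring using (-‿distribˡ-*; -‿distribʳ-*)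
  open import Algebra.Solver.CommutativeMonoid *-commutativeMonoid using (solve; _⊕_; _⊜_)
  open import Relation.Binary.Reasoning.Setoid setoid
  private
    module Σ+ = CommutativeMonoidSum +-commutativeMonoid
    module Π* = CommutativeMonoidSum *-commutativeMonoid

  ∑≡sum : ∀ {k} (f : Fin k → Carrier) → ∑ R f ≡ Σ+.sum f
  ∑≡sum {zero}  f = refl
  ∑≡sum {suc k} f = cong (f zero +_) (∑≡sum (f ∘ suc))

  ∏≡product : ∀ {k} (f : Fin k → Carrier) → ∏ R f ≡ Π*.sum f
  ∏≡product {zero}  f = refl
  ∏≡product {suc k} f = cong (f zero *_) (∏≡product (f ∘ suc))

  ∑-cong : ∀ {k} {f g : Fin k → Carrier} → (∀ i → f i ≈ g i) → ∑ R f ≈ ∑ R g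
  ∑-cong {zero}  f≈g = ≈-refl
  ∑-cong {suc k} f≈g = +-cong (f≈g zero) (∑-cong (f≈g ∘ suc))

  ∏-cong : ∀ {k} {f g : Fin k → Carrier} → (∀ i → f i ≈ g i) → ∏ R f ≈ ∏ R g
  ∏-cong {zero}  f≈g = ≈-refl
  ∏-cong {suc k} f≈g = *-cong (f≈g zero) (∏-cong (f≈g ∘ suc))

  ∑-zero : ∀ {k} {f : Fin k → Carrier} → (∀ i → f i ≈ 0#) → ∑ R f ≈ 0#
  ∑-zero {zero}  f≈0 = ≈-refl
  ∑-zero {suc k} f≈0 = trans (+-cong (f≈0 zero) (∑-zero (f≈0 ∘ suc))) (+-identityˡ 0#)

  ∑-neg : ∀ {k} (f : Fin k → Carrier) → ∑ R (λ i → - f i) ≈ - ∑ R f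
  ∑-neg {zero}  f = sym ε⁻¹≈ε
  ∑-neg {suc k} f = trans (+-congˡ (∑-neg (f ∘ suc))) (⁻¹-∙-comm _ _)

  ∑-distrib-+ : ∀ {k} (f g : Fin k → Carrier) → ∑ R (λ i → f i + g i) ≈ ∑ R f + ∑ R g
  ∑-distrib-+ f g = begin
    ∑ R (λ i → f i + g i)   ≡⟨ ∑≡sum (λ i → f i + g i) ⟩
    Σ+.sum (λ i → f i + g i) ≈⟨ Σ+.∑-distrib-+ f g ⟩
    Σ+.sum f + Σ+.sum g      ≡⟨ cong₂ _+_ (∑≡sum f) (∑≡sum g) ⟨
    ∑ R f + ∑ R g ∎

  *-distribˡ-∑ : ∀ {k} x (f : Fin k → Carrier) → x * ∑ R f ≈ ∑ R (λ i → x * f i)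
  *-distribˡ-∑ {zero}  x f = zeroʳ x
  *-distribˡ-∑ {suc k} x f = trans (distribˡ x _ _) (+-congˡ (*-distribˡ-∑ x (f ∘ suc)))

  *-distribʳ-∑ : ∀ {k} x (f : Fin k → Carrier) → ∑ R f * x ≈ ∑ R (λ i → f i * x)
  *-distribʳ-∑ {zero}  x f = zeroˡ x
  *-distribʳ-∑ {suc k} x f = trans (distribʳ x _ _) (+-congˡ (*-distribʳ-∑ x (f ∘ suc)))

  ∑-↑ : ∀ m {n} (f : Fin (m ℕ.+ n) → Carrier) → ∑ R f ≈ ∑ R (λ i → f (i ↑ˡ n)) + ∑ R (λ j → f (m ↑ʳ j))
  ∑-↑ zero    f = sym (+-identityˡ _)
  ∑-↑ (suc m) f = trans (+-congˡ (∑-↑ m (f ∘ suc))) (sym (+-assoc _ _ _))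

  ∑-removeAt : ∀ {k} (i : Fin (suc k)) (f : Fin (suc k) → Carrier) → ∑ R f ≈ f i + ∑ R (f ∘ punchIn i)
  ∑-removeAt i f = begin
    ∑ R f                     ≡⟨ ∑≡sum f ⟩
    Σ+.sum f                  ≈⟨ Σ+.sum-remove f ⟩
    f i + Σ+.sum (f ∘ punchIn i) ≡⟨ cong (f i +_) (∑≡sum (f ∘ punchIn i)) ⟨
    f i + ∑ R (f ∘ punchIn i) ∎

  ∑-permute : ∀ {k} (π : Permutation′ k) (f : Fin k → Carrier) → ∑ R f ≈ ∑ R (f ∘ (π ⟨$⟩ʳ_))
  ∑-permute π f = begin
    ∑ R f                    ≡⟨ ∑≡sum f ⟩
    Σ+.sum f                 ≈⟨ Σ+.∑-permute f π ⟩
    Σ+.sum (f ∘ (π ⟨$⟩ʳ_))   ≡⟨ ∑≡sum (f ∘ (π ⟨$⟩ʳ_)) ⟨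
    ∑ R (f ∘ (π ⟨$⟩ʳ_)) ∎

  ∏-permute : ∀ {k} (π : Permutation′ k) (f : Fin k → Carrier) → ∏ R f ≈ ∏ R (f ∘ (π ⟨$⟩ʳ_))
  ∏-permute π f = begin
    ∏ R f                    ≡⟨ ∏≡product f ⟩
    Π*.sum f                 ≈⟨ Π*.∑-permute f π ⟩
    Π*.sum (f ∘ (π ⟨$⟩ʳ_))   ≡⟨ ∏≡product (f ∘ (π ⟨$⟩ʳ_)) ⟨
    ∏ R (f ∘ (π ⟨$⟩ʳ_)) ∎

  ∑-comm : ∀ {m n} (f : Fin m → Fin n → Carrier) →
    ∑ R (λ i → ∑ R (f i)) ≈ ∑ R (λ j → ∑ R (λ i → f i j))
  ∑-comm f = begin
    ∑ R (λ i → ∑ R (f i))               ≡⟨ ∑∑≡sumsum f ⟩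
    Σ+.sum (λ i → Σ+.sum (f i))         ≈⟨ Σ+.∑-comm f ⟩
    Σ+.sum (λ j → Σ+.sum (λ i → f i j)) ≡⟨ ∑∑≡sumsum (λ j i → f i j) ⟨
    ∑ R (λ j → ∑ R (λ i → f i j)) ∎
    where
    ∑∑≡sumsum : ∀ {m n} (g : Fin m → Fin n → Carrier) → ∑ R (λ i → ∑ R (g i)) ≡ Σ+.sum (λ i → Σ+.sum (g i))
    ∑∑≡sumsum {zero}  g = refl
    ∑∑≡sumsum {suc m} g = cong₂ _+_ (∑≡sum (g zero)) (∑∑≡sumsum (g ∘ suc))

  -- Adding the diagonal to either side gives the full double sum, in one order of summation or the other.
  ∑-offDiagonal-transpose : ∀ {k} (G : Fin (suc k) → Fin (suc k) → Carrier) →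
    ∑ R (λ j → ∑ R (λ l → G j (punchIn j l))) ≈ ∑ R (λ j → ∑ R (λ l → G (punchIn j l) j))
  ∑-offDiagonal-transpose G = ∙-cancelˡ (∑ R (λ j → G j j)) _ _ (begin
    ∑ R (λ j → G j j) + ∑ R (λ j → ∑ R (λ l → G j (punchIn j l)))
      ≈⟨ ∑-distrib-+ (λ j → G j j) (λ j → ∑ R (λ l → G j (punchIn j l))) ⟨
    ∑ R (λ j → G j j + ∑ R (λ l → G j (punchIn j l)))
      ≈⟨ ∑-cong (λ j → ∑-removeAt j (G j)) ⟨
    ∑ R (λ j → ∑ R (G j))
      ≈⟨ ∑-comm G ⟩
    ∑ R (λ a → ∑ R (λ j → G j a))
      ≈⟨ ∑-cong (λ a → ∑-removeAt a (λ j → G j a)) ⟩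
    ∑ R (λ a → G a a + ∑ R (λ l → G (punchIn a l) a))
      ≈⟨ ∑-distrib-+ (λ j → G j j) (λ j → ∑ R (λ l → G (punchIn j l) j)) ⟩
    ∑ R (λ j → G j j) + ∑ R (λ j → ∑ R (λ l → G (punchIn j l) j)) ∎)

  firstRowMinor : ∀ {k} → Matrix R (suc k) → Fin (suc k) → Matrix R k
  firstRowMinor M j r s = M (suc r) (punchIn j s)

  laplaceTerm : ∀ {k} → Matrix R (suc k) → Fin (suc k) → Carrier
  laplaceTerm M j = sign R j * (M zero j * det R (firstRowMinor M j))

  det-cong : ∀ {k} {M N : Matrix R k} → (∀ r s → M r s ≈ N r s) → det R M ≈ det R N
  det-cong {zero}  M≈N = ≈-refl
  det-cong {suc k} M≈N = ∑-cong λ j →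
    *-congˡ {sign R j} (*-cong (M≈N zero j) (det-cong (λ r s → M≈N (suc r) (punchIn j s))))

  det-cong-≡ : ∀ {k} {M N : Matrix R k} → (∀ r s → M r s ≡ N r s) → det R M ≈ det R N
  det-cong-≡ M≡N = det-cong (λ r s → reflexive (M≡N r s))

  sign-inject₁ : ∀ {k} (a : Fin k) → sign R (inject₁ a) ≡ sign R a
  sign-inject₁ zero    = refl
  sign-inject₁ (suc a) = cong -_ (sign-inject₁ a)

  sign-↑ˡ : ∀ {a} b (r : Fin a) → sign R (r ↑ˡ b) ≡ sign R r
  sign-↑ˡ b zero    = refl
  sign-↑ˡ b (suc r) = cong -_ (sign-↑ˡ b r)

  neg-*-neg : ∀ x y → (- x) * (- y) ≈ x * y
  neg-*-neg x y = begin
    (- x) * (- y) ≈⟨ -‿distribˡ-* x (- y) ⟨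
    - (x * - y)   ≈⟨ -‿cong (-‿distribʳ-* x y) ⟨
    - - (x * y)   ≈⟨ ⁻¹-involutive (x * y) ⟩
    x * y ∎

  swapAdjacentColumns : ∀ {k} → Fin k → Matrix R (suc k) → Matrix R (suc k)
  swapAdjacentColumns a M r s = M r (adjacentSwap a s)

  det-swapAdjacentColumns : ∀ {k} (a : Fin k) (M : Matrix R (suc k)) →
    det R (swapAdjacentColumns a M) ≈ - det R M
  laplaceTerm-swapAdjacentColumns : ∀ {k} (a : Fin (suc k)) (M : Matrix R (suc (suc k))) l →
    laplaceTerm (swapAdjacentColumns a M) (adjacentSwap a l) ≈ - laplaceTerm M l

  det-swapAdjacentColumns {suc k} a M = begin
    ∑ R (laplaceTerm (swapAdjacentColumns a M))
      ≈⟨ ∑-permute (adjacentSwapₚ a) (laplaceTerm (swapAdjacentColumns a M)) ⟩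
    ∑ R (laplaceTerm (swapAdjacentColumns a M) ∘ adjacentSwap a)
      ≈⟨ ∑-cong (laplaceTerm-swapAdjacentColumns a M) ⟩
    ∑ R (λ l → - laplaceTerm M l)
      ≈⟨ ∑-neg (laplaceTerm M) ⟩
    - det R M ∎

  laplaceTerm-swapAdjacentColumns a M l with adjacentSwap-cases a l
  ... | inj₁ refl = begin
    laplaceTerm (swapAdjacentColumns a M) (adjacentSwap a (inject₁ a))
      ≡⟨ cong (laplaceTerm (swapAdjacentColumns a M)) (adjacentSwap-inject₁ a) ⟩
    (- sign R a) * (M zero (adjacentSwap a (suc a)) * det R (firstRowMinor (swapAdjacentColumns a M) (suc a)))
      ≈⟨ *-congˡ (*-cong (reflexive (cong (M zero) (adjacentSwap-suc a)))
                         (det-cong-≡ (λ r s → cong (M (suc r)) (adjacentSwap-punchIn-suc a s)))) ⟩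
    (- sign R a) * (M zero (inject₁ a) * det R (firstRowMinor M (inject₁ a)))
      ≈⟨ -‿distribˡ-* _ _ ⟨
    - (sign R a * (M zero (inject₁ a) * det R (firstRowMinor M (inject₁ a))))
      ≡⟨ cong (λ σ → - (σ * (M zero (inject₁ a) * det R (firstRowMinor M (inject₁ a))))) (sign-inject₁ a) ⟨
    - laplaceTerm M (inject₁ a) ∎
  ... | inj₂ (inj₁ refl) = begin
    laplaceTerm (swapAdjacentColumns a M) (adjacentSwap a (suc a))
      ≡⟨ cong (laplaceTerm (swapAdjacentColumns a M)) (adjacentSwap-suc a) ⟩
    sign R (inject₁ a) * (M zero (adjacentSwap a (inject₁ a)) * det R (firstRowMinor (swapAdjacentColumns a M) (inject₁ a)))
      ≈⟨ *-cong (reflexive (sign-inject₁ a))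
           (*-cong (reflexive (cong (M zero) (adjacentSwap-inject₁ a)))
                   (det-cong-≡ (λ r s → cong (M (suc r)) (adjacentSwap-punchIn-inject₁ a s)))) ⟩
    sign R a * (M zero (suc a) * det R (firstRowMinor M (suc a)))
      ≈⟨ ⁻¹-involutive _ ⟨
    - - (sign R a * (M zero (suc a) * det R (firstRowMinor M (suc a))))
      ≈⟨ -‿cong (-‿distribˡ-* _ _) ⟩
    - laplaceTerm M (suc a) ∎
  ... | inj₂ (inj₂ (fixed , b , commute)) = begin
    laplaceTerm (swapAdjacentColumns a M) (adjacentSwap a l)
      ≡⟨ cong (laplaceTerm (swapAdjacentColumns a M)) fixed ⟩
    sign R l * (M zero (adjacentSwap a l) * det R (firstRowMinor (swapAdjacentColumns a M) l))
      ≈⟨ *-congˡ (*-cong (reflexive (cong (M zero) fixed))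
                         (det-cong-≡ (λ r s → cong (M (suc r)) (commute s)))) ⟩
    sign R l * (M zero l * det R (swapAdjacentColumns b (firstRowMinor M l)))
      ≈⟨ *-congˡ (*-congˡ (det-swapAdjacentColumns b (firstRowMinor M l))) ⟩
    sign R l * (M zero l * - det R (firstRowMinor M l))
      ≈⟨ *-congˡ (-‿distribʳ-* _ _) ⟨
    sign R l * - (M zero l * det R (firstRowMinor M l))
      ≈⟨ -‿distribʳ-* _ _ ⟨
    - laplaceTerm M l ∎

  twoRowMinor : ∀ {k} → Matrix R (suc (suc k)) → Fin (suc (suc k)) → Fin (suc k) → Matrix R k
  twoRowMinor M j l r s = M (suc (suc r)) (punchIn j (punchIn l s))

  twoRowTerm : ∀ {k} → Matrix R (suc (suc k)) → Fin (suc (suc k)) → Fin (suc k) → Carrier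
  twoRowTerm M j l = (M zero j * M (suc zero) (punchIn j l)) * ((sign R j * sign R l) * det R (twoRowMinor M j l))

  det-expandTwoRows : ∀ {k} (M : Matrix R (suc (suc k))) → det R M ≈ ∑ R (λ j → ∑ R (twoRowTerm M j))
  det-expandTwoRows M = ∑-cong λ j → begin
    sign R j * (M zero j * ∑ R (λ l → sign R l * (M₁ j l * det R (twoRowMinor M j l))))
      ≈⟨ *-congˡ (*-distribˡ-∑ (M zero j) (λ l → sign R l * (M₁ j l * det R (twoRowMinor M j l)))) ⟩
    sign R j * ∑ R (λ l → M zero j * (sign R l * (M₁ j l * det R (twoRowMinor M j l))))
      ≈⟨ *-distribˡ-∑ (sign R j) (λ l → M zero j * (sign R l * (M₁ j l * det R (twoRowMinor M j l)))) ⟩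
    ∑ R (λ l → sign R j * (M zero j * (sign R l * (M₁ j l * det R (twoRowMinor M j l)))))
      ≈⟨ ∑-cong (λ l → solve 5 (λ a b c d e → a ⊕ (b ⊕ (c ⊕ (d ⊕ e))) ⊜ (b ⊕ d) ⊕ ((a ⊕ c) ⊕ e)) ≈-refl
                     (sign R j) (M zero j) (sign R l) (M₁ j l) (det R (twoRowMinor M j l))) ⟩
    ∑ R (twoRowTerm M j) ∎
    where
    M₁ : _ → _ → Carrier
    M₁ j l = M (suc zero) (punchIn j l)

  sign-punchIn-punchOutTotal : ∀ {k} (j : Fin (suc (suc k))) l →
    let a = punchIn j l in sign R j * sign R l ≈ - (sign R a * sign R (punchOutTotal a j))
  sign-punchIn-punchOutTotal zero l = begin
    1# * sign R l          ≈⟨ *-identityˡ _ ⟩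
    sign R l               ≈⟨ ⁻¹-involutive _ ⟨
    - - sign R l           ≈⟨ -‿cong (*-identityʳ _) ⟨
    - ((- sign R l) * 1#) ∎
  sign-punchIn-punchOutTotal (suc j) zero = begin
    (- sign R j) * 1#  ≈⟨ *-identityʳ _ ⟩
    - sign R j         ≈⟨ -‿cong (*-identityˡ _) ⟨
    - (1# * sign R j) ∎
  sign-punchIn-punchOutTotal {suc k} (suc j) (suc l) = begin
    (- sign R j) * (- sign R l)  ≈⟨ neg-*-neg _ _ ⟩
    sign R j * sign R l          ≈⟨ sign-punchIn-punchOutTotal j l ⟩
    - (sign R a * sign R b)      ≈⟨ -‿cong (neg-*-neg _ _) ⟨
    - ((- sign R a) * (- sign R b)) ∎
    where
    a = punchIn j l
    b = punchOutTotal a j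
  sign-punchIn-punchOutTotal {zero} (suc j) (suc ())

  det-swapAdjacentRows : ∀ {k} (a : Fin k) (M : Matrix R (suc k)) → det R (M ∘ adjacentSwap a) ≈ - det R M
  det-swapAdjacentRows {suc k} (suc a) M = begin
    ∑ R (λ j → sign R j * (M zero j * det R (firstRowMinor M j ∘ adjacentSwap a)))
      ≈⟨ ∑-cong (λ j → *-congˡ {sign R j} (*-congˡ {M zero j} (det-swapAdjacentRows a (firstRowMinor M j)))) ⟩
    ∑ R (λ j → sign R j * (M zero j * - det R (firstRowMinor M j)))
      ≈⟨ ∑-cong (λ j → trans (-‿distribʳ-* (sign R j) _) (*-congˡ (-‿distribʳ-* (M zero j) (det R (firstRowMinor M j))))) ⟨
    ∑ R (λ j → - laplaceTerm M j)
      ≈⟨ ∑-neg (laplaceTerm M) ⟩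
    - det R M ∎
  -- Expanding along the first two rows, the swap exchanges the two columns used by each term, and
  -- sign-punchIn-punchOutTotal says that this flips the sign of the term.
  det-swapAdjacentRows {suc k} zero M = begin
    det R (M ∘ adjacentSwap zero)
      ≈⟨ det-expandTwoRows (M ∘ adjacentSwap zero) ⟩
    ∑ R (λ j → ∑ R (twoRowTerm (M ∘ adjacentSwap zero) j))
      ≈⟨ ∑-cong (λ j → ∑-cong (swapped-term j)) ⟩
    ∑ R (λ j → ∑ R (λ l → - G (punchIn j l) j))
      ≈⟨ ∑-cong (λ j → ∑-neg (λ l → G (punchIn j l) j)) ⟩
    ∑ R (λ j → - ∑ R (λ l → G (punchIn j l) j))
      ≈⟨ ∑-neg (λ j → ∑ R (λ l → G (punchIn j l) j)) ⟩
    - ∑ R (λ j → ∑ R (λ l → G (punchIn j l) j))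
      ≈⟨ -‿cong (∑-offDiagonal-transpose G) ⟨
    - ∑ R (λ j → ∑ R (λ l → G j (punchIn j l)))
      ≈⟨ -‿cong (∑-cong (λ j → ∑-cong (λ l → reflexive (G-punchIn j l)))) ⟩
    - ∑ R (λ j → ∑ R (twoRowTerm M j))
      ≈⟨ -‿cong (det-expandTwoRows M) ⟨
    - det R M ∎
    where
    term : Fin (suc (suc k)) → Fin (suc (suc k)) → Fin (suc k) → Carrier
    term j a b = (M zero j * M (suc zero) a) * ((sign R j * sign R b) * det R (twoRowMinor M j b))
    G : Fin (suc (suc k)) → Fin (suc (suc k)) → Carrier
    G j a = term j a (punchOutTotal j a)
    G-punchIn : ∀ j l → G j (punchIn j l) ≡ twoRowTerm M j l
    G-punchIn j l = cong (term j (punchIn j l)) (punchOutTotal-punchIn j l)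
    swapped-term : ∀ j l → twoRowTerm (M ∘ adjacentSwap zero) j l ≈ - G (punchIn j l) j
    swapped-term j l = begin
      (M (suc zero) j * M zero a) * ((sign R j * sign R l) * det R (twoRowMinor M j l))
        ≈⟨ *-cong (*-comm _ _) (*-cong (sign-punchIn-punchOutTotal j l)
                                       (det-cong-≡ (λ r s → cong (M (suc (suc r))) (punchIn-punchIn-swap j l s)))) ⟩
      (M zero a * M (suc zero) j) * ((- (sign R a * sign R b)) * det R (twoRowMinor M a b))
        ≈⟨ *-congˡ (-‿distribˡ-* _ _) ⟨
      (M zero a * M (suc zero) j) * - ((sign R a * sign R b) * det R (twoRowMinor M a b))
        ≈⟨ -‿distribʳ-* _ _ ⟨
      - G a j ∎
      where
      a = punchIn j l
      b = punchOutTotal a j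

  det-conjugate-adjacentSwap : ∀ {k} (a : Fin k) (M : Matrix R (suc k)) →
    det R (λ r s → M (adjacentSwap a r) (adjacentSwap a s)) ≈ det R M
  det-conjugate-adjacentSwap a M = begin
    det R (λ r s → M (adjacentSwap a r) (adjacentSwap a s)) ≈⟨ det-swapAdjacentRows a (swapAdjacentColumns a M) ⟩
    - det R (swapAdjacentColumns a M)                        ≈⟨ -‿cong (det-swapAdjacentColumns a M) ⟩
    - - det R M                                              ≈⟨ ⁻¹-involutive _ ⟩
    det R M ∎

  det-conjugate-applySwaps : ∀ {k} (w : List (Fin k)) (M : Matrix R (suc k)) →
    det R (λ r s → M (applySwaps w r) (applySwaps w s)) ≈ det R M
  det-conjugate-applySwaps []      M = ≈-refl
  det-conjugate-applySwaps (a ∷ w) M = trans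
    (det-conjugate-applySwaps w (λ r s → M (adjacentSwap a r) (adjacentSwap a s)))
    (det-conjugate-adjacentSwap a M)

  det-conjugate : ∀ {m n} (π : Permutation m n) (M : Matrix R n) →
    det R (λ r s → M (π ⟨$⟩ʳ r) (π ⟨$⟩ʳ s)) ≈ det R M
  det-conjugate {m} {n} π M with m ℕ.≟ n
  ... | no m≢n = contradiction π (Perm.refute m≢n)
  det-conjugate {zero}  π M | yes refl = ≈-refl
  det-conjugate {suc k} π M | yes refl = trans
    (det-cong-≡ (λ r s → cong₂ M (proj₂ swaps r) (proj₂ swaps s)))
    (det-conjugate-applySwaps (proj₁ swaps) M)
    where swaps = permutation-adjacentSwaps π

  det-blockLowerTriangular : ∀ a b (N : Matrix R (a ℕ.+ b)) → (∀ r s → N (r ↑ˡ b) (a ↑ʳ s) ≈ 0#) →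
    det R N ≈ det R (λ r s → N (r ↑ˡ b) (s ↑ˡ b)) * det R (λ r s → N (a ↑ʳ r) (a ↑ʳ s))
  det-blockLowerTriangular zero    b N upper≈0 = sym (*-identityˡ _)
  det-blockLowerTriangular (suc a) b N upper≈0 = begin
    ∑ R (laplaceTerm N)                                        ≈⟨ ∑-↑ (suc a) (laplaceTerm N) ⟩
    ∑ R (laplaceTerm N ∘ (_↑ˡ b)) + ∑ R (laplaceTerm N ∘ (suc a ↑ʳ_)) ≈⟨ +-cong (∑-cong left) (∑-zero right) ⟩
    ∑ R (λ r → laplaceTerm A r * det R D) + 0#                 ≈⟨ +-identityʳ _ ⟩
    ∑ R (λ r → laplaceTerm A r * det R D)                      ≈⟨ *-distribʳ-∑ (det R D) (laplaceTerm A) ⟨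
    det R A * det R D ∎
    where
    A : Matrix R (suc a)
    A r s = N (r ↑ˡ b) (s ↑ˡ b)
    D : Matrix R b
    D r s = N (suc a ↑ʳ r) (suc a ↑ʳ s)
    right : ∀ s → laplaceTerm N (suc a ↑ʳ s) ≈ 0#
    right s = trans (*-congˡ (trans (*-congʳ (upper≈0 zero s)) (zeroˡ _))) (zeroʳ _)
    left : ∀ r → laplaceTerm N (r ↑ˡ b) ≈ laplaceTerm A r * det R D
    left r = begin
      sign R (r ↑ˡ b) * (N zero (r ↑ˡ b) * det R (firstRowMinor N (r ↑ˡ b)))
        ≈⟨ *-cong (reflexive (sign-↑ˡ b r))
                  (*-congˡ (det-blockLowerTriangular a b (firstRowMinor N (r ↑ˡ b)) (λ x s →
                    trans (reflexive (cong (N (suc x ↑ˡ b)) (punchIn-↑ˡ-↑ʳ b r s))) (upper≈0 (suc x) s)))) ⟩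
      sign R r * (A zero r * (det R (λ x y → N (suc x ↑ˡ b) (punchIn (r ↑ˡ b) (y ↑ˡ b))) *
                              det R (λ x y → N (suc a ↑ʳ x) (punchIn (r ↑ˡ b) (a ↑ʳ y)))))
        ≈⟨ *-congˡ (*-congˡ (*-cong (det-cong-≡ (λ x y → cong (N (suc x ↑ˡ b)) (punchIn-↑ˡ b r y)))
                                    (det-cong-≡ (λ x y → cong (N (suc a ↑ʳ x)) (punchIn-↑ˡ-↑ʳ b r y))))) ⟩
      sign R r * (A zero r * (det R (firstRowMinor A r) * det R D))
        ≈⟨ solve 4 (λ p q u v → p ⊕ (q ⊕ (u ⊕ v)) ⊜ (p ⊕ (q ⊕ u)) ⊕ v) ≈-refl _ _ _ _ ⟩
      laplaceTerm A r * det R D ∎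

  det-blocksLowerTriangular : ∀ {t} (size : Fin t → ℕ) (N : Matrix R (sumℕ size)) →
    (∀ x y → toℕ (proj₁ (blockSplit size x)) < toℕ (proj₁ (blockSplit size y)) → N x y ≈ 0#) →
    det R N ≈ ∏ R (λ i → det R (principal R N (blockJoin size i)))
  det-blocksLowerTriangular {zero}  size N upper≈0 = ≈-refl
  det-blocksLowerTriangular {suc t} size N upper≈0 = trans
    (det-blockLowerTriangular (size zero) (sumℕ (size ∘ suc)) N (λ r s → upper≈0 _ _ (first<rest r s)))
    (*-congˡ (det-blocksLowerTriangular (size ∘ suc) (λ r s → N (size zero ↑ʳ r) (size zero ↑ʳ s)) upper′≈0))
    where
    first<rest : ∀ r s → toℕ (proj₁ (blockSplit size (r ↑ˡ sumℕ (size ∘ suc)))) < toℕ (proj₁ (blockSplit size (size zero ↑ʳ s)))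
    first<rest r s rewrite blockSplit-↑ˡ size r | blockSplit-↑ʳ size s = s≤s z≤n
    upper′≈0 : ∀ x y → toℕ (proj₁ (blockSplit (size ∘ suc) x)) < toℕ (proj₁ (blockSplit (size ∘ suc) y)) →
      N (size zero ↑ʳ x) (size zero ↑ʳ y) ≈ 0#
    upper′≈0 x y x<y = upper≈0 _ _ (subst₂ (λ u v → toℕ u < toℕ v)
      (≡.sym (blockSplit-↑ʳ size x)) (≡.sym (blockSplit-↑ʳ size y)) (s≤s x<y))

  -- Sorting the blocks by key and renumbering the indices block by block makes the matrix block lower triangular.
  det-blockTriangular : ∀ {n t} (M : Matrix R n) (size : Fin t → ℕ) (e : ∀ i → Fin (size i) → Fin n)
    (part : Σ (Fin t) (Fin ∘ size) ↔ Fin n) → (∀ i p → Inverse.to part (i , p) ≡ e i p) →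
    (key : Fin t → ℕ) → (∀ i j p q → i ≢ j → key i ≤ key j → M (e i p) (e j q) ≈ 0#) →
    det R M ≈ ∏ R (λ i → det R (principal R M (e i)))
  det-blockTriangular M size e part part≡e key upper≈0 = begin
    det R M
      ≈⟨ det-conjugate E M ⟨
    det R N
      ≈⟨ det-blocksLowerTriangular sortedSize N N-upper≈0 ⟩
    ∏ R (λ i → det R (principal R N (blockJoin sortedSize i)))
      ≈⟨ ∏-cong (λ i → det-cong-≡ (λ r s → cong₂ M (E-blockJoin i r) (E-blockJoin i s))) ⟩
    ∏ R (λ i → det R (principal R M (e (π ⟨$⟩ʳ i))))
      ≈⟨ ∏-permute π (λ i → det R (principal R M (e i))) ⟨
    ∏ R (λ i → det R (principal R M (e i))) ∎
    where
    π = proj₁ (sortingPermutation key)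
    sortedSize : Fin _ → ℕ
    sortedSize = size ∘ (π ⟨$⟩ʳ_)
    E : Permutation (sumℕ sortedSize) _
    E = part ↔-∘ (Σ-↔ π (↔-id _) ↔-∘ blockSplit-↔ sortedSize)
    E-blockJoin : ∀ i p → E ⟨$⟩ʳ blockJoin sortedSize i p ≡ e (π ⟨$⟩ʳ i) p
    E-blockJoin i p = ≡.trans (cong (λ (j , q) → Inverse.to part (π ⟨$⟩ʳ j , q)) (blockSplit-blockJoin sortedSize i p)) (part≡e _ _)
    N : Matrix R (sumℕ sortedSize)
    N r s = M (E ⟨$⟩ʳ r) (E ⟨$⟩ʳ s)
    N-upper≈0 : ∀ x y → toℕ (proj₁ (blockSplit sortedSize x)) < toℕ (proj₁ (blockSplit sortedSize y)) → N x y ≈ 0#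
    N-upper≈0 x y x<y = trans (reflexive (cong₂ M (part≡e _ _) (part≡e _ _)))
      (upper≈0 _ _ _ _ (λ eq → <-irrefl (cong toℕ (Injection.injective (↔⇒↣ π) eq)) x<y) (proj₂ (sortingPermutation key) _ _ x<y))

  δ-≢ : ∀ {k} {a b : Fin k} → a ≢ b → δ R a b ≡ 0#
  δ-≢ {a = a} {b} a≢b with a ≟ b
  ... | yes a≡b = ⊥-elim (a≢b a≡b)
  ... | no  _   = refl

  δ-≡ : ∀ {k} {a b : Fin k} → a ≡ b → δ R a b ≡ 1#
  δ-≡ {a = a} {b} a≡b with a ≟ b
  ... | yes _   = refl
  ... | no  a≢b = ⊥-elim (a≢b a≡b)

  δ-injective : ∀ {k m} (f : Fin k → Fin m) → (∀ {p q} → f p ≡ f q → p ≡ q) → ∀ r s → δ R (f r) (f s) ≡ δ R r s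
  δ-injective f f-injective r s with r ≟ s
  ... | yes r≡s = δ-≡ (cong f r≡s)
  ... | no  r≢s = δ-≢ (r≢s ∘ f-injective)

  charMatrix : ∀ {k} → Matrix R k → Carrier → Matrix R k
  charMatrix M x i j = x * δ R i j - M i j

  charMatrix-principal : ∀ {n k} (M : Matrix R n) (e : Fin k → Fin n) → (∀ {p q} → e p ≡ e q → p ≡ q) →
    ∀ x r s → principal R (charMatrix M x) e r s ≡ charMatrix (principal R M e) x r s
  charMatrix-principal M e e-injective x r s = cong (λ d → x * d - M (e r) (e s)) (δ-injective e e-injective r s)

  Aα-charMatrix-nonadjacent : ∀ {n} (G : MixedGraph n) α x {a b} → a ≢ b → adj G a b ≡ false →
    charMatrix (Aα R G α) x a b ≈ 0#
  Aα-charMatrix-nonadjacent G α x {a} {b} a≢b a↛b = begin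
    x * δ R a b - ((α * fromℕ R (outDeg G a)) * δ R a b + (1# - α) * fromBool R (adj G a b))
      ≡⟨ cong₂ (λ d e → x * d - ((α * fromℕ R (outDeg G a)) * d + (1# - α) * fromBool R e)) (δ-≢ a≢b) a↛b ⟩
    x * 0# - ((α * fromℕ R (outDeg G a)) * 0# + (1# - α) * 0#)
      ≈⟨ +-cong (zeroʳ x) (-‿cong (trans (+-cong (zeroʳ _) (zeroʳ _)) (+-identityˡ 0#))) ⟩
    0# - 0#
      ≈⟨ -‿inverseʳ 0# ⟩
    0# ∎

-- Leaves and potentials of mixed trees

open import Data.Nat using (_+_; _*_)
open import Data.Nat.Properties
  using (+-commutativeSemigroup; module ≤-Reasoning; _<?_; +-monoʳ-≤; +-monoˡ-≤; +-monoʳ-<;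
         1+n≰n; +-cancelˡ-<; +-cancelˡ-≡; ≮⇒≥; *-suc; ≤-antisym; ≤-pred; *-monoʳ-<; n<1+n)
open import Algebra.Properties.CommutativeSemigroup +-commutativeSemigroup using (interchange; x∙yz≈y∙xz)

indicator : Bool → ℕ
indicator b = if b then 1 else 0

countRow≡sumℕ : ∀ {k} (f : Fin k → Bool) → countRow f ≡ sumℕ (indicator ∘ f)
countRow≡sumℕ {zero}  f = refl
countRow≡sumℕ {suc k} f = cong (indicator (f zero) +_) (countRow≡sumℕ (f ∘ suc))

sumℕ-cong : ∀ {k} {f g : Fin k → ℕ} → (∀ i → f i ≡ g i) → sumℕ f ≡ sumℕ g
sumℕ-cong {zero}  f≡g = refl
sumℕ-cong {suc k} f≡g = cong₂ _+_ (f≡g zero) (sumℕ-cong (f≡g ∘ suc))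

sumℕ-distrib-+ : ∀ {k} (f g : Fin k → ℕ) → sumℕ (λ i → f i + g i) ≡ sumℕ f + sumℕ g
sumℕ-distrib-+ {zero}  f g = refl
sumℕ-distrib-+ {suc k} f g = ≡.trans
  (cong (f zero + g zero +_) (sumℕ-distrib-+ (f ∘ suc) (g ∘ suc))) (interchange (f zero) (g zero) _ _)

sumℕ-punchIn : ∀ {k} (f : Fin (suc k) → ℕ) v → sumℕ f ≡ f v + sumℕ (f ∘ punchIn v)
sumℕ-punchIn f zero = refl
sumℕ-punchIn {suc k} f (suc v) = ≡.trans (cong (f zero +_) (sumℕ-punchIn (f ∘ suc) v)) (x∙yz≈y∙xz (f zero) (f (suc v)) _)

countRow-punchIn : ∀ {k} (f : Fin (suc k) → Bool) v → countRow f ≡ indicator (f v) + countRow (f ∘ punchIn v)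
countRow-punchIn f v = begin
  countRow f                                        ≡⟨ countRow≡sumℕ f ⟩
  sumℕ (indicator ∘ f)                              ≡⟨ sumℕ-punchIn (indicator ∘ f) v ⟩
  indicator (f v) + sumℕ (indicator ∘ f ∘ punchIn v) ≡⟨ cong (indicator (f v) +_) (countRow≡sumℕ (f ∘ punchIn v)) ⟨
  indicator (f v) + countRow (f ∘ punchIn v) ∎
  where open ≡.≡-Reasoning

countRow-positive : ∀ {k} (f : Fin k → Bool) {y} → f y ≡ true → 1 ≤ countRow f
countRow-positive {suc k} f {y} fy≡true rewrite countRow-punchIn f y | fy≡true = s≤s z≤n

countRow≡1⇒unique : ∀ {k} (f : Fin (suc k) → Bool) {u w} →
  countRow f ≡ 1 → f u ≡ true → f w ≡ true → w ≡ u
countRow≡1⇒unique f {u} {w} count≡1 fu≡true fw≡true with w ≟ u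
... | yes w≡u = w≡u
... | no  w≢u = ⊥-elim (1+n≰n (begin
  2                                 ≡⟨⟩
  1 + 1                             ≤⟨ +-monoʳ-≤ 1 (countRow-positive (f ∘ punchIn u) fw′≡true) ⟩
  1 + countRow (f ∘ punchIn u)      ≡⟨ cong (λ b → indicator b + countRow (f ∘ punchIn u)) fu≡true ⟨
  indicator (f u) + countRow (f ∘ punchIn u) ≡⟨ countRow-punchIn f u ⟨
  countRow f                        ≡⟨ count≡1 ⟩
  1 ∎))
  where
  open ≤-Reasoning
  u≢w = w≢u ∘ ≡.sym
  fw′≡true : f (punchIn u (punchOut u≢w)) ≡ true
  fw′≡true = ≡.trans (cong f (punchIn-punchOut u≢w)) fw≡true

sumℕ<2*⇒∃<2 : ∀ {k} (f : Fin k → ℕ) → sumℕ f < 2 * k → Σ (Fin k) λ i → f i < 2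
sumℕ<2*⇒∃<2 {zero}  f ()
sumℕ<2*⇒∃<2 {suc k} f sum< with f zero <? 2
... | yes f₀<2 = zero , f₀<2
... | no  f₀≮2 = let (i , fᵢ<2) = sumℕ<2*⇒∃<2 (f ∘ suc) rest< in suc i , fᵢ<2
  where
  rest< : sumℕ (f ∘ suc) < 2 * k
  rest< = +-cancelˡ-< 2 _ _ (begin-strict
    2 + sumℕ (f ∘ suc)      ≤⟨ +-monoˡ-≤ _ (≮⇒≥ f₀≮2) ⟩
    f zero + sumℕ (f ∘ suc) <⟨ sum< ⟩
    2 * suc k               ≡⟨ *-suc 2 k ⟩
    2 + 2 * k ∎)
    where open ≤-Reasoning

removeVertex : ∀ {n} → MixedGraph (suc n) → Fin (suc n) → MixedGraph n
removeVertex G v = record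
  { adj      = λ i j → adj G (punchIn v i) (punchIn v j)
  ; loopless = loopless G ∘ punchIn v
  }

degree : ∀ {n} → MixedGraph n → Fin n → ℕ
degree G i = countRow (underlying G i)

underlying-sym : ∀ {n} (G : MixedGraph n) i j → underlying G i j ≡ underlying G j i
underlying-sym G i j = ∨-comm (adj G i j) (adj G j i)

underlying-irrefl : ∀ {n} (G : MixedGraph n) i → underlying G i i ≡ false
underlying-irrefl G i rewrite loopless G i = refl

record Leaf {n} (G : MixedGraph (suc n)) (v : Fin (suc n)) : Set where
  field
    neighbour : Fin (suc n)
    adjacent  : underlyingEdge G v neighbour
    degree≡1  : degree G v ≡ 1

  unique : ∀ {w} → underlyingEdge G v w → w ≡ neighbour
  unique = countRow≡1⇒unique (underlying G v) degree≡1 adjacent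

  leaf≢neighbour : v ≢ neighbour
  leaf≢neighbour v≡u with ≡.trans (≡.sym (subst (underlyingEdge G v) (≡.sym v≡u) adjacent)) (underlying-irrefl G v)
  ... | ()

-- A vertex of degree at most 1 exists because the degrees sum to 2(n − 1); it is not isolated because the tree is connected.
tree-leaf : ∀ {n} (T : MixedGraph (suc (suc n))) → IsMixedTree T → Σ (Fin (suc (suc n))) (Leaf T)
tree-leaf {n} T (connected , edgeCount , _) = v , record
  { neighbour = u ; adjacent = v─u ; degree≡1 = degree≡1 }
  where
  small = sumℕ<2*⇒∃<2 (degree T) (subst (_< 2 * suc (suc n)) (≡.sym edgeCount) (*-monoʳ-< 2 (n<1+n (suc n))))
  v = proj₁ small
  firstStep : ∀ {x y} → Star (underlyingEdge T) x y → x ≢ y → Σ _ (underlyingEdge T x)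
  firstStep ε          x≢x = ⊥-elim (x≢x refl)
  firstStep (x─z ◅ _)  _   = _ , x─z
  v─ = firstStep (connected v (punchIn v zero)) (punchInᵢ≢i v zero ∘ ≡.sym)
  u = proj₁ v─
  v─u = proj₂ v─
  degree≡1 : degree T v ≡ 1
  degree≡1 = ≤-antisym (≤-pred (proj₂ small)) (countRow-positive (underlying T v) v─u)

module _ {n} {T : MixedGraph (suc n)} {v : Fin (suc n)} (L : Leaf T v) where
  private
    T′ = removeVertex T v
    open Leaf L

  removeLeaf-edge : ∀ {x z} (v≢x : v ≢ x) (v≢z : v ≢ z) →
    underlyingEdge T x z → underlyingEdge T′ (punchOut v≢x) (punchOut v≢z)
  removeLeaf-edge v≢x v≢z = subst₂ (underlyingEdge T) (≡.sym (punchIn-punchOut v≢x)) (≡.sym (punchIn-punchOut v≢z))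

  -- A path can only enter and leave the leaf through its neighbour, so the detour can be cut out.
  removeLeaf-path : ∀ {x y} → Star (underlyingEdge T) x y → (v≢x : v ≢ x) (v≢y : v ≢ y) →
    Star (underlyingEdge T′) (punchOut v≢x) (punchOut v≢y)
  removeLeaf-path ε v≢x v≢y = subst (Star (underlyingEdge T′) (punchOut v≢x)) (punchOut-cong v refl) ε
  removeLeaf-path {x} (_◅_ {j = z} x─z z─*y) v≢x v≢y with v ≟ z
  ... | no v≢z = removeLeaf-edge v≢x v≢z x─z ◅ removeLeaf-path z─*y v≢z v≢y
  removeLeaf-path {x} (x─v ◅ ε) v≢x v≢y | yes refl = ⊥-elim (v≢y refl)
  removeLeaf-path {x} (x─v ◅ (_◅_ {j = z′} v─z′ z′─*y)) v≢x v≢y | yes refl =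
    subst (λ a → Star (underlyingEdge T′) a (punchOut v≢y)) (punchOut-cong v z′≡x) (removeLeaf-path z′─*y v≢z′ v≢y)
    where
    z′≡x : z′ ≡ x
    z′≡x = ≡.trans (unique v─z′) (≡.sym (unique (≡.trans (underlying-sym T v x) x─v)))
    v≢z′ : v ≢ z′
    v≢z′ v≡z′ = leaf≢neighbour (≡.trans v≡z′ (unique v─z′))

  removeLeaf-connected : (∀ i j → Star (underlyingEdge T) i j) → ∀ i j → Star (underlyingEdge T′) i j
  removeLeaf-connected connected i j = subst₂ (Star (underlyingEdge T′)) (punchOut-punchIn v) (punchOut-punchIn v)
    (removeLeaf-path (connected (punchIn v i) (punchIn v j)) (punchInᵢ≢i v i ∘ ≡.sym) (punchInᵢ≢i v j ∘ ≡.sym))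

  removeLeaf-countPairs : countPairs (underlying T) ≡ 2 + countPairs (underlying T′)
  removeLeaf-countPairs = begin
    sumℕ (degree T)
      ≡⟨ sumℕ-punchIn (degree T) v ⟩
    degree T v + sumℕ (degree T ∘ punchIn v)
      ≡⟨ cong₂ _+_ degree≡1 (sumℕ-cong (λ i → countRow-punchIn (underlying T (punchIn v i)) v)) ⟩
    1 + sumℕ (λ i → indicator (underlying T (punchIn v i) v) + degree T′ i)
      ≡⟨ cong (1 +_) (sumℕ-distrib-+ _ (degree T′)) ⟩
    1 + (sumℕ (λ i → indicator (underlying T (punchIn v i) v)) + sumℕ (degree T′))
      ≡⟨ cong (λ m → 1 + (m + sumℕ (degree T′))) edgesAtLeaf ⟩
    2 + sumℕ (degree T′) ∎
    where
    open ≡.≡-Reasoning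
    edgesAtLeaf : sumℕ (λ i → indicator (underlying T (punchIn v i) v)) ≡ 1
    edgesAtLeaf = begin
      sumℕ (λ i → indicator (underlying T (punchIn v i) v))
        ≡⟨ sumℕ-cong (λ i → cong indicator (underlying-sym T (punchIn v i) v)) ⟩
      sumℕ (indicator ∘ underlying T v ∘ punchIn v)
        ≡⟨ countRow≡sumℕ (underlying T v ∘ punchIn v) ⟨
      countRow (underlying T v ∘ punchIn v)
        ≡⟨ cong (λ b → indicator b + countRow (underlying T v ∘ punchIn v)) (underlying-irrefl T v) ⟨
      indicator (underlying T v v) + countRow (underlying T v ∘ punchIn v)
        ≡⟨ countRow-punchIn (underlying T v) v ⟨
      degree T v
        ≡⟨ degree≡1 ⟩
      1 ∎

  removeLeaf-isMixedTree : IsMixedTree T → 1 ≤ n → IsMixedTree T′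
  removeLeaf-isMixedTree (connected , edgeCount , _) 1≤n@(s≤s _) = removeLeaf-connected connected ,
    +-cancelˡ-≡ 2 _ _ (≡.trans (≡.sym removeLeaf-countPairs) (≡.trans edgeCount (*-suc 2 _))) , 1≤n

-- With a = adj i j and b = adj j i: an undirected edge ij forces equal heights, an arc i→j a strict descent.
Respects : Bool → Bool → ℕ → ℕ → Set
Respects a b hᵢ hⱼ = (a ≡ true → b ≡ true → hᵢ ≡ hⱼ) × (a ≡ true → b ≡ false → hⱼ < hᵢ)

record Potential {n} (G : MixedGraph n) : Set where
  field
    height   : Fin n → ℕ
    respects : ∀ i j → Respects (adj G i j) (adj G j i) (height i) (height j)

respects-nonadjacent : ∀ {b x y} → Respects false b x y
respects-nonadjacent = (λ ()) , (λ ())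

respects-+ : ∀ {a b x y} s → Respects a b x y → Respects a b (s + x) (s + y)
respects-+ s (level , descend) = (λ a b → cong (s +_) (level a b)) , (λ a b → +-monoʳ-< s (descend a b))

respects-if-adjacent : ∀ a b {x y} → (a ∨ b ≡ true → Respects a b x y) → Respects a b x y
respects-if-adjacent false false _       = respects-nonadjacent
respects-if-adjacent false true  respect = respect refl
respects-if-adjacent true  b     respect = respect refl

-- The shift s lifts the old heights so that an arc into the new vertex can still descend (to hᵥ = 0).
leafHeights : ∀ a b h → Σ ℕ λ hᵥ → Σ ℕ λ s → Respects a b hᵥ (s + h) × Respects b a (s + h) hᵥ
leafHeights true  true  h = h     , 0 , ((λ _ _ → refl) , (λ _ ())) , ((λ _ _ → refl) , (λ _ ()))
leafHeights true  false h = suc h , 0 , ((λ _ ()) , (λ _ _ → n<1+n h)) , respects-nonadjacent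
leafHeights false true  h = 0     , 1 , respects-nonadjacent , ((λ _ ()) , (λ _ _ → s≤s z≤n))
leafHeights false false h = 0     , 0 , respects-nonadjacent , respects-nonadjacent

module _ {n} {T : MixedGraph (suc n)} {v : Fin (suc n)} (L : Leaf T v) (P′ : Potential (removeVertex T v)) where
  private
    open Leaf L
    open Potential P′ renaming (height to h′; respects to respects′)
    u = neighbour
    fit = leafHeights (adj T v u) (adj T u v) (h′ (punchOut leaf≢neighbour))
    hᵥ = proj₁ fit
    s = proj₁ (proj₂ fit)

    height : Fin (suc n) → ℕ
    height x with v ≟ x
    ... | yes _   = hᵥ
    ... | no v≢x  = s + h′ (punchOut v≢x)

    fitsNeighbour : ∀ {j} (v≢j : v ≢ j) → underlyingEdge T v j →
      Respects (adj T v j) (adj T j v) hᵥ (s + h′ (punchOut v≢j)) × Respects (adj T j v) (adj T v j) (s + h′ (punchOut v≢j)) hᵥ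
    fitsNeighbour v≢j v─j with unique v─j
    ... | refl rewrite punchOut-cong v {i≢j = v≢j} {i≢k = leaf≢neighbour} refl = proj₂ (proj₂ fit)

    respects : ∀ i j → Respects (adj T i j) (adj T j i) (height i) (height j)
    respects i j with v ≟ i | v ≟ j
    ... | yes refl | yes refl = subst (λ a → Respects a a hᵥ hᵥ) (≡.sym (loopless T v)) respects-nonadjacent
    ... | yes refl | no v≢j = respects-if-adjacent (adj T v j) (adj T j v) λ v─j → proj₁ (fitsNeighbour v≢j v─j)
    ... | no v≢i | yes refl = respects-if-adjacent (adj T i v) (adj T v i) λ i─v →
      proj₂ (fitsNeighbour v≢i (≡.trans (underlying-sym T v i) i─v))
    ... | no v≢i | no v≢j = subst₂ (λ a b → Respects a b (s + h′ (punchOut v≢i)) (s + h′ (punchOut v≢j)))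
      (cong₂ (adj T) (punchIn-punchOut v≢i) (punchIn-punchOut v≢j))
      (cong₂ (adj T) (punchIn-punchOut v≢j) (punchIn-punchOut v≢i))
      (respects-+ s (respects′ (punchOut v≢i) (punchOut v≢j)))

  extendPotential : Potential T
  extendPotential = record { height = height ; respects = respects }

tree-potential : ∀ {n} (T : MixedGraph n) → IsMixedTree T → Potential T
tree-potential {zero} T (_ , _ , ())
tree-potential {suc zero} T _ = record { height = λ _ → 0 ; respects = λ { zero zero →
  subst (λ a → Respects a a 0 0) (≡.sym (loopless T zero)) respects-nonadjacent } }
tree-potential {suc (suc n)} T isTree = extendPotential L
  (tree-potential (removeVertex T v) (removeLeaf-isMixedTree L isTree (s≤s z≤n)))
  where
  v = proj₁ (tree-leaf T isTree)
  L = proj₂ (tree-leaf T isTree)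

-- Components

height-sameComponent : ∀ {n} {G : MixedGraph n} (P : Potential G) {a b} →
  SameComponent G a b → Potential.height P a ≡ Potential.height P b
height-sameComponent P ε             = refl
height-sameComponent P (a─b ◅ b─*c) = ≡.trans
  (proj₁ (Potential.respects P _ _) (∧-conicalˡ _ _ a─b) (∧-conicalʳ _ _ a─b)) (height-sameComponent P b─*c)

module _ {n} {G : MixedGraph n} (C : ComponentListing G) where
  open ComponentListing C

  elems-injective : ∀ {i j p q} → elems i p ≡ elems j q → (i , p) ≡ (j , q)
  elems-injective {i} {j} {p} {q} eq = Bijection.injective partition
    (≡.trans (partition-is-elems i p) (≡.trans eq (≡.sym (partition-is-elems j q))))

  elems-injectiveʳ : ∀ {i p q} → elems i p ≡ elems i q → p ≡ q
  elems-injectiveʳ eq with elems-injective eq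
  ... | refl = refl

  module _ (P : Potential G) where
    open Potential P

    -- Junk value: an empty block gets height 0.
    blockHeight : Fin t → ℕ
    blockHeight i with size i | elems i
    ... | zero  | _ = 0
    ... | suc _ | e = height (e zero)

    blockHeight-elems : ∀ i p → height (elems i p) ≡ blockHeight i
    blockHeight-elems i p with size i | elems i | connected-within i
    ... | suc _ | e | connected = height-sameComponent P (connected p zero)

    no-ascending-arc : ∀ i j p q → i ≢ j → blockHeight i ≤ blockHeight j → adj G (elems i p) (elems j q) ≡ false
    no-ascending-arc i j p q i≢j hᵢ≤hⱼ with adj G (elems i p) (elems j q) in a→b | adj G (elems j q) (elems i p) in b→a
    ... | false | _     = refl
    ... | true  | true  = ⊥-elim (i≢j (separated-between i j p q (cong₂ _∧_ a→b b→a ◅ ε)))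
    ... | true  | false = ⊥-elim (<⇒≱ (subst₂ _<_ (blockHeight-elems j q) (blockHeight-elems i p)
                                         (proj₂ (respects _ _) a→b b→a)) hᵢ≤hⱼ)

lemma5p1 : {c ℓ : Level} (R : CommutativeRing c ℓ) →
    let open CommutativeRing R in
    (n : ℕ) (T : MixedGraph n) → IsMixedTree T →
    (C : ComponentListing T) →
    (α x : Carrier) →
    charAt R (Aα R T α) x
    ≈ ∏ R (λ i → charAt R (principal R (Aα R T α) (ComponentListing.elems C i)) x)
lemma5p1 R n T isTree C α x = R.trans
  (det-blockTriangular R (charMatrix R A x) size elems (⤖⇒↔ partition) partition-is-elems (blockHeight C P)
    (λ i j p q i≢j hᵢ≤hⱼ → Aα-charMatrix-nonadjacent R T α x
      (i≢j ∘ cong proj₁ ∘ elems-injective C) (no-ascending-arc C P i j p q i≢j hᵢ≤hⱼ)))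
  (∏-cong R λ i → det-cong-≡ R (charMatrix-principal R A (elems i) (elems-injectiveʳ C) x))
  where
  module R = CommutativeRing R
  open ComponentListing C
  P = tree-potential T isTree
  A = Aα R T α
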